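{- Let $H=(\mathcal{X},\xi)$ be a hypergraph with transversal number $k=\tau(H)$, and let $T=\{x_1,\dots,x_k\}$ be a minimal transversal of $H$ of cardinality $k$, its vertices indexed in decreasing order of support (the number of hyperedges containing the vertex). For $i=1,\dots,k$ define the partial hypergraph $H_i=(\mathcal{X}_i,\xi_i)$ by $\xi_i=\{e\in\xi\setminus\bigcup_{j=1}^{i-1}\xi_j : x_i\in e\}$ and $\mathcal{X}_i=\bigcup_{e\in\xi_i}e$, and let $\mathcal{M}_{H_i}$ be the set of minimal transversals of $H_i$. Then every inclusion-minimal member $T'$ of the family $\{T_1\cup T_2\cup\dots\cup T_k : T_i\in\mathcal{M}_{H_i},\ i=1,\dots,k\}$ is a minimal transversal of $H$.
   Context: A hypergraph $H=(\mathcal{X},\xi)$ consists of a finite set $\mathcal{X}$ and a family $\xi$ of nonempty subsets (hyperedges) of $\mathcal{X}$ whose union is $\mathcal{X}$. A transversal of $H$ is a set of vertices meeting every hyperedge; it is minimal if no other transversal is strictly contained in it. The transversal number $\tau(H)$ is the minimum cardinality of a minimal transversal of $H$. -}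

module Defs where

open import Data.Nat using (ℕ; _≤_)
open import Data.Fin using (Fin)
open import Data.Fin.Subset using (Subset; _∈_; _⊆_; _∩_; _∪_; _─_; ⊥; ⊤; ∣_∣; Nonempty)
open import Data.Vec using (Vec; []; _∷_; lookup; tabulate)
open import Data.Product using (Σ; ∃; _×_)
open import Relation.Binary.PropositionalEquality using (_≡_)

-- A hypergraph on vertex set Fin n with m hyperedges, given as an
-- indexed family  E : Fin m → Subset n.
-- A partial hypergraph is given by a set S : Subset m of edge indices;
-- its vertex set is the union of its edges.

InVerts : ∀ {n m} → (Fin m → Subset n) → Subset m → Fin n → Set
InVerts E S v = ∃ λ e → e ∈ S × v ∈ E e

IsTransversal : ∀ {n m} → (Fin m → Subset n) → Subset m → Subset n → Set
IsTransversal E S T =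
  (∀ v → v ∈ T → InVerts E S v) × (∀ e → e ∈ S → Nonempty (E e ∩ T))

IsMinTransversal : ∀ {n m} → (Fin m → Subset n) → Subset m → Subset n → Set
IsMinTransversal E S T =
  IsTransversal E S T × (∀ T' → IsTransversal E S T' → T' ⊆ T → T ⊆ T')

IsHypergraph : ∀ {n m} → (Fin m → Subset n) → Set
IsHypergraph E = (∀ e → Nonempty (E e)) × (∀ v → InVerts E ⊤ v)

edgesAt : ∀ {n m} → (Fin m → Subset n) → Fin n → Subset m
edgesAt E v = tabulate (λ e → lookup (E e) v)

support : ∀ {n m} → (Fin m → Subset n) → Fin n → ℕ
support E v = ∣ edgesAt E v ∣

-- ξ_1, …, ξ_k for the sequence of vertices xs, where `used` is
-- ξ_1 ∪ … ∪ ξ_{i-1}:  ξ_i = {e ∈ ξ ∖ used : x_i ∈ e}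
partsFrom : ∀ {n m k} → (Fin m → Subset n) → Vec (Fin n) k → Subset m → Vec (Subset m) k
partsFrom E [] used = []
partsFrom E (x ∷ xs) used =
  (edgesAt E x ─ used) ∷ partsFrom E xs (used ∪ (edgesAt E x ─ used))

xi : ∀ {n m k} → (Fin m → Subset n) → (Fin k → Fin n) → Fin k → Subset m
xi E x i = lookup (partsFrom E (tabulate x) ⊥) i

bigUnion : ∀ {n k} → (Fin k → Subset n) → Subset n
bigUnion {n} {k} Ts = go (tabulate Ts)
  where
  go : ∀ {j} → Vec (Subset n) j → Subset n
  go [] = ⊥
  go (t ∷ ts) = t ∪ go ts

module Submission where

open import Defs
open import Data.Nat using (ℕ; _≤_; _<_)
open import Data.Nat.Induction using (<-wellFounded)
open import Data.Fin using (Fin; zero; suc)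
open import Data.Fin.Subset using (Subset; _∈_; _⊆_; ⊤; ∣_∣; _∩_; _∪_; _─_; _-_; ⊥; Nonempty)
open import Data.Fin.Subset.Properties
open import Data.Fin.Properties using (any?; all?)
open import Data.Vec using (Vec; _∷_; lookup; tabulate)
open import Data.Vec.Properties using (lookup∘tabulate; []=⇒lookup; lookup⇒[]=)
open import Data.Product using (∃; _×_; _,_; proj₁; proj₂)
open import Data.Sum using (inj₁; inj₂; _⊎_)
open import Data.Empty using (⊥-elim)
open import Function using (_∘_)
open import Function.Definitions using (Injective)
open import Induction.WellFounded using (Acc; acc)
open import Relation.Nullary using (Dec; yes; no; does; _×-dec_; _→-dec_)
open import Relation.Nullary.Decidable using (dec-true)
open import Level using (0ℓ)
open import Relation.Unary using (Pred; Decidable)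
open import Relation.Binary.PropositionalEquality using (_≡_; refl; sym; trans; subst)

-- The union U of the T_i is a transversal of H because the ξ_i cover ξ: an
-- edge meets T in some x_i, so it is either in ξ_i or in an earlier ξ_j.
-- U is minimal because any transversal T' ⊆ U of H restricts, on the vertices
-- of each H_i, to a transversal of H_i, which contains a minimal one R_i; then
-- ⋃ R_i ⊆ T' ⊆ U, and minimality of U in the family gives U ⊆ ⋃ R_i ⊆ T'.

subsetOf : ∀ {n} {P : Pred (Fin n) 0ℓ} → Decidable P → Subset n
subsetOf P? = tabulate (does ∘ P?)

∈-subsetOf⁺ : ∀ {n} {P : Pred (Fin n) 0ℓ} (P? : Decidable P) {v} → P v → v ∈ subsetOf P?
∈-subsetOf⁺ P? {v} p =
  lookup⇒[]= v _ (trans (lookup∘tabulate (does ∘ P?) v) (dec-true (P? v) p))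

∈-subsetOf⁻ : ∀ {n} {P : Pred (Fin n) 0ℓ} (P? : Decidable P) {v} → v ∈ subsetOf P? → P v
∈-subsetOf⁻ P? {v} v∈ with P? v | trans (sym (lookup∘tabulate (does ∘ P?) v)) ([]=⇒lookup v∈)
... | yes p | _ = p
... | no _ | ()

∈-edgesAt⁺ : ∀ {n m} (E : Fin m → Subset n) {e v} → v ∈ E e → e ∈ edgesAt E v
∈-edgesAt⁺ E {e} {v} v∈e =
  lookup⇒[]= e _ (trans (lookup∘tabulate (λ e′ → lookup (E e′) v) e) ([]=⇒lookup v∈e))

∈-bigUnion⁺ : ∀ {n k} (Ts : Fin k → Subset n) i {v} → v ∈ Ts i → v ∈ bigUnion Ts
∈-bigUnion⁺ Ts zero v∈ = x∈p∪q⁺ (inj₁ v∈)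
∈-bigUnion⁺ Ts (suc i) v∈ = x∈p∪q⁺ {p = Ts zero} (inj₂ (∈-bigUnion⁺ (Ts ∘ suc) i v∈))

∈-bigUnion⁻ : ∀ {n k} (Ts : Fin k → Subset n) {v} → v ∈ bigUnion Ts → ∃ λ i → v ∈ Ts i
∈-bigUnion⁻ {k = ℕ.zero} Ts v∈ = ⊥-elim (∉⊥ v∈)
∈-bigUnion⁻ {k = ℕ.suc k} Ts v∈ with x∈p∪q⁻ (Ts zero) (bigUnion (Ts ∘ suc)) v∈
... | inj₁ v∈T₀ = zero , v∈T₀
... | inj₂ v∈rest with ∈-bigUnion⁻ (Ts ∘ suc) v∈rest
... | i , v∈Tᵢ = suc i , v∈Tᵢ

bigUnion-least : ∀ {n k} (Ts : Fin k → Subset n) {D} → (∀ i → Ts i ⊆ D) → bigUnion Ts ⊆ D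
bigUnion-least Ts Ts⊆D v∈ with ∈-bigUnion⁻ Ts v∈
... | i , v∈Tᵢ = Ts⊆D i v∈Tᵢ

partsFrom-cover : ∀ {n m k} (E : Fin m → Subset n) (xs : Vec (Fin n) k) used i {e} →
  e ∈ edgesAt E (lookup xs i) → e ∈ used ⊎ ∃ λ j → e ∈ lookup (partsFrom E xs used) j
partsFrom-cover E (x ∷ xs) used zero {e} e∈ with e ∈? used
... | yes e∈used = inj₁ e∈used
... | no e∉used = inj₂ (zero , x∈p∧x∉q⇒x∈p─q e∈ e∉used)
partsFrom-cover E (x ∷ xs) used (suc i) e∈ with partsFrom-cover E xs (used ∪ (edgesAt E x ─ used)) i e∈
... | inj₂ (j , e∈part) = inj₂ (suc j , e∈part)
... | inj₁ e∈used′ with x∈p∪q⁻ used _ e∈used′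
... | inj₁ e∈used = inj₁ e∈used
... | inj₂ e∈first = inj₂ (zero , e∈first)

xi-cover : ∀ {n m k} (E : Fin m → Subset n) (x : Fin k → Fin n) i {e} →
  x i ∈ E e → ∃ λ j → e ∈ xi E x j
xi-cover E x i {e} xᵢ∈e
  with partsFrom-cover E (tabulate x) ⊥ i
         (∈-edgesAt⁺ E (subst (_∈ E e) (sym (lookup∘tabulate x i)) xᵢ∈e))
... | inj₁ e∈⊥ = ⊥-elim (∉⊥ e∈⊥)
... | inj₂ part = part

Hits : ∀ {n m} → (Fin m → Subset n) → Subset m → Subset n → Set
Hits E S C = ∀ e → e ∈ S → Nonempty (E e ∩ C)

hits? : ∀ {n m} (E : Fin m → Subset n) S C → Dec (Hits E S C)
hits? E S C = all? (λ e → (e ∈? S) →-dec nonempty? (E e ∩ C))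

hits-mono : ∀ {n m} (E : Fin m → Subset n) S {C D} → C ⊆ D → Hits E S C → Hits E S D
hits-mono E S {C} C⊆D hits e e∈S with hits e e∈S
... | v , v∈e∩C with x∈p∩q⁻ (E e) C v∈e∩C
... | v∈e , v∈C = v , x∈p∩q⁺ (v∈e , C⊆D v∈C)

bigUnion-hits : ∀ {n m k} (E : Fin m → Subset n) S (Ss : Fin k → Subset m) (Ts : Fin k → Subset n) →
  (∀ e → e ∈ S → ∃ λ j → e ∈ Ss j) → (∀ j → Hits E (Ss j) (Ts j)) → Hits E S (bigUnion Ts)
bigUnion-hits E S Ss Ts cover hits e e∈S with cover e e∈S
... | j , e∈Sⱼ = hits-mono E (Ss j) (∈-bigUnion⁺ Ts j) (hits j) e e∈Sⱼ

inVerts? : ∀ {n m} (E : Fin m → Subset n) S → Decidable (InVerts E S)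
inVerts? E S v = any? (λ e → (e ∈? S) ×-dec (v ∈? E e))

vertices : ∀ {n m} → (Fin m → Subset n) → Subset m → Subset n
vertices E S = subsetOf (inVerts? E S)

restrict-transversal : ∀ {n m} (E : Fin m → Subset n) S {C} →
  Hits E S C → IsTransversal E S (C ∩ vertices E S)
restrict-transversal E S {C} hits = inVerts , hitsRestricted
  where
  inVerts : ∀ v → v ∈ C ∩ vertices E S → InVerts E S v
  inVerts v v∈ = ∈-subsetOf⁻ (inVerts? E S) (proj₂ (x∈p∩q⁻ C _ v∈))

  hitsRestricted : Hits E S (C ∩ vertices E S)
  hitsRestricted e e∈S with hits e e∈S
  ... | v , v∈e∩C with x∈p∩q⁻ (E e) C v∈e∩C
  ... | v∈e , v∈C = v , x∈p∩q⁺ (v∈e , x∈p∩q⁺ (v∈C , ∈-subsetOf⁺ (inVerts? E S) (e , e∈S , v∈e)))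

-- If no single vertex can be dropped, C is minimal, since hitting is upward closed.
minimalTransversal-⊆ : ∀ {n m} (E : Fin m → Subset n) S {C} →
  IsTransversal E S C → ∃ λ R → R ⊆ C × IsMinTransversal E S R
minimalTransversal-⊆ E S {C} t = go C t (<-wellFounded ∣ C ∣)
  where
  go : ∀ C → IsTransversal E S C → Acc _<_ ∣ C ∣ →
       ∃ λ R → R ⊆ C × IsMinTransversal E S R
  go C (inVerts , hits) (acc smaller)
    with any? (λ v → (v ∈? C) ×-dec hits? E S (C - v))
  ... | yes (v , v∈C , hits-v) with go (C - v) ((λ w → inVerts w ∘ p─q⊆p C _) , hits-v)
                                      (smaller (x∈p⇒∣p-x∣<∣p∣ v∈C))
  ...   | R , R⊆C-v , min = R , p─q⊆p C _ ∘ R⊆C-v , min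
  go C (inVerts , hits) _ | no irredundant = C , (λ w∈ → w∈) , (inVerts , hits) , minimal
    where
    minimal : ∀ T′ → IsTransversal E S T′ → T′ ⊆ C → C ⊆ T′
    minimal T′ (_ , hits′) T′⊆C {v} v∈C with v ∈? T′
    ... | yes v∈T′ = v∈T′
    ... | no v∉T′ = ⊥-elim (irredundant (v , v∈C , hits-mono E S T′⊆C-v hits′))
      where
      T′⊆C-v : T′ ⊆ C - v
      T′⊆C-v w∈ = x∈p∧x≢y⇒x∈p-y (T′⊆C w∈) (λ { refl → v∉T′ w∈ })

bigUnion-minimal : ∀ {n m k} (E : Fin m → Subset n) (Ss : Fin k → Subset m) (Ts : Fin k → Subset n) →
  (∀ Ts′ → (∀ i → IsMinTransversal E (Ss i) (Ts′ i)) → bigUnion Ts′ ⊆ bigUnion Ts → bigUnion Ts ⊆ bigUnion Ts′) →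
  ∀ T′ → (∀ i → Hits E (Ss i) T′) → T′ ⊆ bigUnion Ts → bigUnion Ts ⊆ T′
bigUnion-minimal E Ss Ts least T′ hits T′⊆U =
  bigUnion-least R R⊆T′ ∘ least R (proj₂ ∘ proj₂ ∘ sub) (T′⊆U ∘ bigUnion-least R R⊆T′)
  where
  sub : ∀ i → ∃ λ R → R ⊆ T′ ∩ vertices E (Ss i) × IsMinTransversal E (Ss i) R
  sub i = minimalTransversal-⊆ E (Ss i) (restrict-transversal E (Ss i) (hits i))

  R : Fin _ → Subset _
  R = proj₁ ∘ sub

  R⊆T′ : ∀ i → R i ⊆ T′
  R⊆T′ i = p∩q⊆p T′ _ ∘ proj₁ (proj₂ (sub i))

mainTheorem3 : ∀ {n m : ℕ} (E : Fin m → Subset n) → IsHypergraph E →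
    ∀ (k : ℕ) (T : Subset n) → IsMinTransversal E ⊤ T → ∣ T ∣ ≡ k →
    (∀ S → IsMinTransversal E ⊤ S → k ≤ ∣ S ∣) →
    ∀ (x : Fin k → Fin n) → Injective _≡_ _≡_ x →
    (∀ i → x i ∈ T) → (∀ v → v ∈ T → ∃ λ i → x i ≡ v) →
    (∀ i j → Data.Fin._≤_ i j → support E (x j) ≤ support E (x i)) →
    ∀ (Ts : Fin k → Subset n) →
    (∀ i → IsMinTransversal E (xi E x i) (Ts i)) →
    (∀ (Ts' : Fin k → Subset n) →
       (∀ i → IsMinTransversal E (xi E x i) (Ts' i)) →
       bigUnion Ts' ⊆ bigUnion Ts → bigUnion Ts ⊆ bigUnion Ts') →
    IsMinTransversal E ⊤ (bigUnion Ts)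
mainTheorem3 E (_ , covered) k T ((_ , T-hits) , _) _ _ x _ _ T⊆x _ Ts Ts-min least =
  ((λ v _ → covered v) , bigUnion-hits E ⊤ (xi E x) Ts xi-covers (proj₂ ∘ proj₁ ∘ Ts-min)) ,
  λ T′ (_ , T′-hits) → bigUnion-minimal E (xi E x) Ts least T′ (λ i e _ → T′-hits e ∈⊤)
  where
  xi-covers : ∀ e → e ∈ ⊤ → ∃ λ j → e ∈ xi E x j
  xi-covers e e∈⊤ with T-hits e e∈⊤
  ... | v , v∈e∩T with x∈p∩q⁻ (E e) T v∈e∩T
  ... | v∈e , v∈T with T⊆x v v∈T
  ... | i , refl = xi-cover E x i v∈e
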